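{- Let $A,B$ be two distinct letters. For every non-negative integer $n$, in $\mathbb{Q}\langle A,B\rangle$ we have \[ \sum_{r=-n}^{n}(-1)^r\left[(AB)^{n-r}\,\text{ш}\,(AB)^{n+r}\right]=4^n\,(A^2B^2)^n. \]
   Context: $\mathbb{Q}\langle A,B\rangle$ is the $\mathbb{Q}$-vector space with basis all words (finite, possibly empty, sequences of letters) over the alphabet $\{A,B\}$; $w^k$ denotes $k$ consecutive copies of the word $w$ (so $A^2B^2=AABB$). The shuffle product ш is the bilinear operation defined on words $u=x_1\cdots x_n$, $v=x_{n+1}\cdots x_{n+m}$ by $u\,\text{ш}\,v=\sum_\sigma x_{\sigma(1)}x_{\sigma(2)}\cdots x_{\sigma(n+m)}$, the sum over all permutations $\sigma$ of $\{1,\ldots,n+m\}$ with $\sigma^{ -1}(j)<\sigma^{ -1}(k)$ whenever $1\le j<k\le n$ or $n+1\le j<k\le n+m$ (counted with multiplicity). -}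

module Defs where

open import Data.Nat using (ℕ; zero; suc; _+_; _∸_)
open import Data.Integer as ℤ using (ℤ)
open import Data.Rational as ℚ using (ℚ; 0ℚ; 1ℚ)
open import Data.List using (List; []; _∷_; _++_; map; concatMap; replicate; concat; upTo)
open import Data.Product using (_×_; _,_)
open import Data.Bool using (Bool; true; false; if_then_else_)
open import Relation.Binary.PropositionalEquality using (_≡_)
open import Relation.Nullary.Decidable using (⌊_⌋)

data Letter : Set where
  A B : Letter

Word : Set
Word = List Letter

_≟L_ : (x y : Letter) → Bool
A ≟L A = true
B ≟L B = true
_ ≟L _ = false

_≟W_ : Word → Word → Bool
[] ≟W [] = true
(x ∷ u) ≟W (y ∷ v) = if x ≟L y then u ≟W v else false
_ ≟W _ = false

_^W_ : Word → ℕ → Word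
w ^W k = concat (replicate k w)

-- Elements of ℚ⟨A,B⟩ represented as finite formal linear combinations of words.
Poly : Set
Poly = List (ℚ × Word)

coeff : Poly → Word → ℚ
coeff [] w = 0ℚ
coeff ((c , u) ∷ p) w = (if u ≟W w then c else 0ℚ) ℚ.+ coeff p w

_≈P_ : Poly → Poly → Set
p ≈P q = ∀ w → coeff p w ≡ coeff q w

word : Word → Poly
word w = (1ℚ , w) ∷ []

scale : ℚ → Poly → Poly
scale c p = map (λ { (d , u) → (c ℚ.* d , u) }) p

-- Shuffle of two words, as a list of words counted with multiplicity
-- (one entry per admissible permutation σ).
shuffleW : Word → Word → List Word
shuffleW [] v = v ∷ []
shuffleW (x ∷ u) [] = (x ∷ u) ∷ []
shuffleW (x ∷ u) (y ∷ v) =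
  map (x ∷_) (shuffleW u (y ∷ v)) ++ map (y ∷_) (shuffleW (x ∷ u) v)

_ш_ : Word → Word → Poly
u ш v = map (λ w → (1ℚ , w)) (shuffleW u v)

-- Σ_{r=-n}^{n} (-1)^r [(AB)^{n-r} ш (AB)^{n+r}], indexing r = i - n with i = 0..2n,
-- so n - r = 2n - i, n + r = i, and (-1)^r = (-1)^(i+n).
sign : ℕ → ℚ
sign zero = 1ℚ
sign (suc k) = ℚ.- sign k

lhs : ℕ → Poly
lhs n = concatMap
  (λ i → scale (sign (i + n)) (((A ∷ B ∷ []) ^W ((n + n) ∸ i)) ш ((A ∷ B ∷ []) ^W i)))
  (upTo (suc (n + n)))

_^Q_ : ℚ → ℕ → ℚ
q ^Q zero = 1ℚ
q ^Q suc k = q ℚ.* (q ^Q k)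

four : ℚ
four = ℤ.+ 4 ℚ./ 1

rhs : ℕ → Poly
rhs n = scale (four ^Q n) (word ((A ∷ A ∷ B ∷ B ∷ []) ^W n))

{-# OPTIONS --safe #-}
-- Write T₀₀ w m for the coefficient of w in Σ_{a+b=m} (-1)^b (AB)^a ш (AB)^b, and T₀₁, T₁₀, T₁₁
-- for the same sums with (AB)^a, resp. (AB)^b, replaced by B(AB)^a, resp. B(AB)^b. Since
-- ⟨u ш v, xw⟩ = ⟨x⁻¹u ш v, w⟩ + ⟨u ш x⁻¹v, w⟩, these four sums form a linear automaton reading w:
-- reading AA sends T₀₀ to -2 T₁₁, reading BB sends T₁₁ to 2 T₀₀, and every other pair of letters
-- gives 0. Hence T₀₀ w (2n) is (-4)ⁿ at w = (AABB)ⁿ and 0 elsewhere; the theorem's sign (-1)^r,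
-- with r = b - n, contributes a further (-1)ⁿ.
module Submission where

open import Defs
open import Algebra.Bundles using (CommutativeMonoid)
open import Data.Bool using (true; false; if_then_else_)
open import Data.Bool.Properties using (if-eta)
open import Data.List using (List; []; _∷_; _++_; map; concatMap; applyUpTo)
open import Data.List.Properties using (map-++)
open import Data.Nat using (ℕ; zero; suc; _∸_) renaming (_+_ to _+ℕ_)
open import Data.Nat.Properties using (+-suc; m+n∸n≡m) renaming (+-identityʳ to +ℕ-identityʳ)
open import Data.Product using (_,_)
open import Data.Rational using (ℚ; 0ℚ; 1ℚ; _+_; _*_; -_; _-_)
open import Data.Rational.Properties
  using (+-identityˡ; +-identityʳ; +-inverseʳ; +-assoc; +-comm; *-identityˡ; *-identityʳ; *-zeroʳ;
         *-assoc; *-comm; *-distribˡ-+; neg-distrib-+; neg-distribˡ-*; +-0-commutativeMonoid)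
open import Data.Rational.Solver using (module +-*-Solver)
open import Relation.Binary.PropositionalEquality
  using (_≡_; refl; sym; trans; cong; cong₂; module ≡-Reasoning)
open import Algebra.Properties.CommutativeSemigroup
  (CommutativeMonoid.commutativeSemigroup +-0-commutativeMonoid) using (interchange; x∙yz≈y∙xz)

*-if-else-0ℚ : ∀ k b {x} → k * (if b then x else 0ℚ) ≡ (if b then k * x else 0ℚ)
*-if-else-0ℚ k true = refl
*-if-else-0ℚ k false = *-zeroʳ k

coeff-++ : ∀ p q w → coeff (p ++ q) w ≡ coeff p w + coeff q w
coeff-++ [] q w = sym (+-identityˡ (coeff q w))
coeff-++ ((d , u) ∷ p) q w =
  trans (cong (c +_) (coeff-++ p q w)) (sym (+-assoc c (coeff p w) (coeff q w)))
  where c = if u ≟W w then d else 0ℚ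

coeff-scale : ∀ k p w → coeff (scale k p) w ≡ k * coeff p w
coeff-scale k [] w = sym (*-zeroʳ k)
coeff-scale k ((d , u) ∷ p) w = begin
  (if u ≟W w then k * d else 0ℚ) + coeff (scale k p) w
    ≡⟨ cong₂ _+_ (sym (*-if-else-0ℚ k (u ≟W w))) (coeff-scale k p w) ⟩
  k * (if u ≟W w then d else 0ℚ) + k * coeff p w
    ≡⟨ *-distribˡ-+ k (if u ≟W w then d else 0ℚ) (coeff p w) ⟨
  k * ((if u ≟W w then d else 0ℚ) + coeff p w) ∎
  where open ≡-Reasoning

multiplicity : List Word → Word → ℚ
multiplicity L w = coeff (map (λ u → (1ℚ , u)) L) w

multiplicity-++ : ∀ L M w → multiplicity (L ++ M) w ≡ multiplicity L w + multiplicity M w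
multiplicity-++ L M w =
  trans (cong (λ p → coeff p w) (map-++ _ L M)) (coeff-++ (map _ L) (map _ M) w)

multiplicity-map-∷-[] : ∀ y L → multiplicity (map (y ∷_) L) [] ≡ 0ℚ
multiplicity-map-∷-[] y [] = refl
multiplicity-map-∷-[] y (u ∷ L) = trans (+-identityˡ _) (multiplicity-map-∷-[] y L)

multiplicity-map-∷ : ∀ y L x w →
  multiplicity (map (y ∷_) L) (x ∷ w) ≡ (if y ≟L x then multiplicity L w else 0ℚ)
multiplicity-map-∷ y [] x w = sym (if-eta (y ≟L x))
multiplicity-map-∷ y (u ∷ L) x w with y ≟L x | multiplicity-map-∷ y L x w
... | true  | ih = cong ((if u ≟W w then 1ℚ else 0ℚ) +_) ih
... | false | ih = trans (+-identityˡ _) ih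

-- f evaluated linearly at the left residual x⁻¹u, which is 0 unless u starts with x.
residual : Letter → Word → (Word → ℚ) → ℚ
residual x [] f = 0ℚ
residual x (y ∷ u) f = if y ≟L x then f u else 0ℚ

-- Listing the (x ∷ w) clause first makes the case tree split on w, so that
-- shuffleCount u v (x ∷ w) unfolds for arbitrary u and v.
shuffleCount : Word → Word → Word → ℚ
shuffleCount u v (x ∷ w) =
  residual x u (λ u′ → shuffleCount u′ v w) + residual x v (λ v′ → shuffleCount u v′ w)
shuffleCount [] [] [] = 1ℚ
shuffleCount _ _ [] = 0ℚ

shuffleCount-[]ˡ : ∀ v w → shuffleCount [] v w ≡ (if v ≟W w then 1ℚ else 0ℚ)
shuffleCount-[]ˡ [] [] = refl
shuffleCount-[]ˡ (y ∷ v) [] = refl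
shuffleCount-[]ˡ [] (x ∷ w) = refl
shuffleCount-[]ˡ (y ∷ v) (x ∷ w) with y ≟L x
... | true  = trans (+-identityˡ _) (shuffleCount-[]ˡ v w)
... | false = refl

shuffleCount-[]ʳ : ∀ u w → shuffleCount u [] w ≡ (if u ≟W w then 1ℚ else 0ℚ)
shuffleCount-[]ʳ [] [] = refl
shuffleCount-[]ʳ (y ∷ u) [] = refl
shuffleCount-[]ʳ [] (x ∷ w) = refl
shuffleCount-[]ʳ (y ∷ u) (x ∷ w) with y ≟L x
... | true  = trans (+-identityʳ _) (shuffleCount-[]ʳ u w)
... | false = refl

coeff-ш : ∀ u v w → coeff (u ш v) w ≡ shuffleCount u v w
coeff-ш [] v w = trans (+-identityʳ _) (sym (shuffleCount-[]ˡ v w))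
coeff-ш (x ∷ u) [] w = trans (+-identityʳ _) (sym (shuffleCount-[]ʳ (x ∷ u) w))
coeff-ш (x ∷ u) (y ∷ v) [] =
  trans (multiplicity-++ (map (x ∷_) L) (map (y ∷_) M) [])
        (cong₂ _+_ (multiplicity-map-∷-[] x L) (multiplicity-map-∷-[] y M))
  where L = shuffleW u (y ∷ v); M = shuffleW (x ∷ u) v
coeff-ш (x ∷ u) (y ∷ v) (z ∷ w) =
  trans (multiplicity-++ (map (x ∷_) L) (map (y ∷_) M) (z ∷ w))
        (cong₂ _+_
          (trans (multiplicity-map-∷ x L z w) (cong (λ t → if x ≟L z then t else 0ℚ) (coeff-ш u (y ∷ v) w)))
          (trans (multiplicity-map-∷ y M z w) (cong (λ t → if y ≟L z then t else 0ℚ) (coeff-ш (x ∷ u) v w))))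
  where L = shuffleW u (y ∷ v); M = shuffleW (x ∷ u) v

shiftʳ : (ℕ → ℕ → ℚ) → ℕ → ℕ → ℚ
shiftʳ g a b = g a (suc b)

antidiagonalSum : (ℕ → ℕ → ℚ) → ℕ → ℚ
antidiagonalSum g zero = g 0 0
antidiagonalSum g (suc m) = g (suc m) 0 + antidiagonalSum (shiftʳ g) m

antidiagonalSum-sucˡ : ∀ g m →
  antidiagonalSum g (suc m) ≡ g 0 (suc m) + antidiagonalSum (λ a b → g (suc a) b) m
antidiagonalSum-sucˡ g zero = +-comm (g 1 0) (g 0 1)
antidiagonalSum-sucˡ g (suc m) =
  trans (cong (g (suc (suc m)) 0 +_) (antidiagonalSum-sucˡ (shiftʳ g) m))
        (x∙yz≈y∙xz (g (suc (suc m)) 0) (g 0 (suc (suc m))) (antidiagonalSum (λ a b → g (suc a) (suc b)) m))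

antidiagonalSum-cong : ∀ m {g h} → (∀ a b → a +ℕ b ≡ m → g a b ≡ h a b) →
  antidiagonalSum g m ≡ antidiagonalSum h m
antidiagonalSum-cong zero g≡h = g≡h 0 0 refl
antidiagonalSum-cong (suc m) g≡h =
  cong₂ _+_ (g≡h (suc m) 0 (cong suc (+ℕ-identityʳ m)))
            (antidiagonalSum-cong m (λ a b a+b≡m → g≡h a (suc b) (trans (+-suc a b) (cong suc a+b≡m))))

antidiagonalSum-zero : ∀ m {g} → (∀ a b → g a b ≡ 0ℚ) → antidiagonalSum g m ≡ 0ℚ
antidiagonalSum-zero zero g≡0 = g≡0 0 0
antidiagonalSum-zero (suc m) g≡0 =
  trans (cong₂ _+_ (g≡0 (suc m) 0) (antidiagonalSum-zero m (λ a b → g≡0 a (suc b))))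
        (+-identityˡ 0ℚ)

antidiagonalSum-+ : ∀ m g h →
  antidiagonalSum (λ a b → g a b + h a b) m ≡ antidiagonalSum g m + antidiagonalSum h m
antidiagonalSum-+ zero g h = refl
antidiagonalSum-+ (suc m) g h =
  trans (cong (g (suc m) 0 + h (suc m) 0 +_) (antidiagonalSum-+ m (shiftʳ g) (shiftʳ h)))
        (interchange (g (suc m) 0) (h (suc m) 0) (antidiagonalSum (shiftʳ g) m) (antidiagonalSum (shiftʳ h) m))

antidiagonalSum-* : ∀ m k g → antidiagonalSum (λ a b → k * g a b) m ≡ k * antidiagonalSum g m
antidiagonalSum-* zero k g = refl
antidiagonalSum-* (suc m) k g =
  trans (cong (k * g (suc m) 0 +_) (antidiagonalSum-* m k (shiftʳ g)))
        (sym (*-distribˡ-+ k (g (suc m) 0) (antidiagonalSum (shiftʳ g) m)))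

antidiagonalSum-neg : ∀ m g → antidiagonalSum (λ a b → - g a b) m ≡ - antidiagonalSum g m
antidiagonalSum-neg zero g = refl
antidiagonalSum-neg (suc m) g =
  trans (cong (- g (suc m) 0 +_) (antidiagonalSum-neg m (shiftʳ g)))
        (sym (neg-distrib-+ (g (suc m) 0) (antidiagonalSum (shiftʳ g) m)))

coeff-concatMap-applyUpTo : ∀ (G : ℕ → Poly) f m w →
  coeff (concatMap G (applyUpTo f (suc m))) w ≡ antidiagonalSum (λ _ b → coeff (G (f b)) w) m
coeff-concatMap-applyUpTo G f zero w = trans (coeff-++ (G (f 0)) [] w) (+-identityʳ _)
coeff-concatMap-applyUpTo G f (suc m) w =
  trans (coeff-++ (G (f 0)) (concatMap G (applyUpTo (λ i → f (suc i)) (suc m))) w)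
        (cong (coeff (G (f 0)) w +_) (coeff-concatMap-applyUpTo G (λ i → f (suc i)) m w))

sign-+ : ∀ m n → sign (m +ℕ n) ≡ sign m * sign n
sign-+ zero n = sym (*-identityˡ (sign n))
sign-+ (suc m) n = trans (cong -_ (sign-+ m n)) (neg-distribˡ-* (sign m) (sign n))

sign-*-neg-^Q : ∀ n q → sign n * (- q) ^Q n ≡ q ^Q n
sign-*-neg-^Q zero q = *-identityˡ 1ℚ
sign-*-neg-^Q (suc n) q =
  trans (solve 3 (λ s q p → (:- s) :* ((:- q) :* p) := q :* (s :* p)) refl (sign n) q ((- q) ^Q n))
        (cong (q *_) (sign-*-neg-^Q n q))
  where open +-*-Solver

AB^ : ℕ → Word
AB^ a = (A ∷ B ∷ []) ^W a

B·AB^ : ℕ → Word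
B·AB^ a = B ∷ AB^ a

alternatingSum : (ℕ → Word) → (ℕ → Word) → Word → ℕ → ℚ
alternatingSum U V w m = antidiagonalSum (λ a b → sign b * shuffleCount (U a) (V b) w) m

leftPart rightPart : (ℕ → Word) → (ℕ → Word) → Letter → Word → ℕ → ℚ
leftPart U V x w m = antidiagonalSum (λ a b → sign b * residual x (U a) (λ u → shuffleCount u (V b) w)) m
rightPart U V x w m = antidiagonalSum (λ a b → sign b * residual x (V b) (λ v → shuffleCount (U a) v w)) m

alternatingSum-∷ : ∀ U V x w m →
  alternatingSum U V (x ∷ w) m ≡ leftPart U V x w m + rightPart U V x w m
alternatingSum-∷ U V x w m =
  trans (antidiagonalSum-cong m (λ a b _ → *-distribˡ-+ (sign b) _ _)) (antidiagonalSum-+ m _ _)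

leftPart-AB^-A : ∀ V w m → leftPart AB^ V A w (suc m) ≡ alternatingSum B·AB^ V w m
leftPart-AB^-A V w m =
  trans (antidiagonalSum-sucˡ (λ a b → sign b * residual A (AB^ a) (λ u → shuffleCount u (V b) w)) m)
        (trans (cong (_+ alternatingSum B·AB^ V w m) (*-zeroʳ (sign (suc m)))) (+-identityˡ _))

leftPart-AB^-B : ∀ V w m → leftPart AB^ V B w m ≡ 0ℚ
leftPart-AB^-B V w m = antidiagonalSum-zero m λ { zero b → *-zeroʳ (sign b) ; (suc a) b → *-zeroʳ (sign b) }

leftPart-B·AB^-A : ∀ V w m → leftPart B·AB^ V A w m ≡ 0ℚ
leftPart-B·AB^-A V w m = antidiagonalSum-zero m λ a b → *-zeroʳ (sign b)

rightPart-AB^-A : ∀ U w m → rightPart U AB^ A w (suc m) ≡ - alternatingSum U B·AB^ w m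
rightPart-AB^-A U w m =
  trans (+-identityˡ _)
  (trans (antidiagonalSum-cong m (λ a b _ → sym (neg-distribˡ-* (sign b) (shuffleCount (U a) (B·AB^ b) w))))
         (antidiagonalSum-neg m _))

rightPart-AB^-B : ∀ U w m → rightPart U AB^ B w m ≡ 0ℚ
rightPart-AB^-B U w m = antidiagonalSum-zero m λ { a zero → *-zeroʳ 1ℚ ; a (suc b) → *-zeroʳ (sign (suc b)) }

rightPart-B·AB^-A : ∀ U w m → rightPart U B·AB^ A w m ≡ 0ℚ
rightPart-B·AB^-A U w m = antidiagonalSum-zero m λ a b → *-zeroʳ (sign b)

T₀₀ T₀₁ T₁₀ T₁₁ : Word → ℕ → ℚ
T₀₀ = alternatingSum AB^ AB^
T₀₁ = alternatingSum AB^ B·AB^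
T₁₀ = alternatingSum B·AB^ AB^
T₁₁ = alternatingSum B·AB^ B·AB^

T₀₀-[] : ∀ m → T₀₀ [] (suc m) ≡ 0ℚ
T₀₀-[] m =
  cong (0ℚ +_) (antidiagonalSum-zero m λ { zero b → *-zeroʳ (sign (suc b)) ; (suc a) b → *-zeroʳ (sign (suc b)) })

T₀₁-[] : ∀ m → T₀₁ [] m ≡ 0ℚ
T₀₁-[] m = antidiagonalSum-zero m λ { zero b → *-zeroʳ (sign b) ; (suc a) b → *-zeroʳ (sign b) }

T₁₀-[] : ∀ m → T₁₀ [] m ≡ 0ℚ
T₁₀-[] m = antidiagonalSum-zero m λ a b → *-zeroʳ (sign b)

T₁₁-[] : ∀ m → T₁₁ [] m ≡ 0ℚ
T₁₁-[] m = antidiagonalSum-zero m λ a b → *-zeroʳ (sign b)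

T₀₀-A : ∀ w m → T₀₀ (A ∷ w) (suc m) ≡ T₁₀ w m - T₀₁ w m
T₀₀-A w m = trans (alternatingSum-∷ AB^ AB^ A w (suc m))
                  (cong₂ _+_ (leftPart-AB^-A AB^ w m) (rightPart-AB^-A AB^ w m))

T₀₀-B : ∀ w m → T₀₀ (B ∷ w) m ≡ 0ℚ
T₀₀-B w m = trans (alternatingSum-∷ AB^ AB^ B w m)
                  (cong₂ _+_ (leftPart-AB^-B AB^ w m) (rightPart-AB^-B AB^ w m))

T₀₁-A : ∀ w m → T₀₁ (A ∷ w) (suc m) ≡ T₁₁ w m
T₀₁-A w m = trans (alternatingSum-∷ AB^ B·AB^ A w (suc m))
  (trans (cong₂ _+_ (leftPart-AB^-A B·AB^ w m) (rightPart-B·AB^-A AB^ w (suc m))) (+-identityʳ _))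

T₀₁-B : ∀ w m → T₀₁ (B ∷ w) m ≡ T₀₀ w m
T₀₁-B w m = trans (alternatingSum-∷ AB^ B·AB^ B w m)
  (trans (cong (_+ T₀₀ w m) (leftPart-AB^-B B·AB^ w m)) (+-identityˡ _))

T₁₀-A : ∀ w m → T₁₀ (A ∷ w) (suc m) ≡ - T₁₁ w m
T₁₀-A w m = trans (alternatingSum-∷ B·AB^ AB^ A w (suc m))
  (trans (cong₂ _+_ (leftPart-B·AB^-A AB^ w (suc m)) (rightPart-AB^-A B·AB^ w m)) (+-identityˡ _))

T₁₀-B : ∀ w m → T₁₀ (B ∷ w) m ≡ T₀₀ w m
T₁₀-B w m = trans (alternatingSum-∷ B·AB^ AB^ B w m)
  (trans (cong (T₀₀ w m +_) (rightPart-AB^-B B·AB^ w m)) (+-identityʳ _))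

T₁₁-A : ∀ w m → T₁₁ (A ∷ w) m ≡ 0ℚ
T₁₁-A w m = trans (alternatingSum-∷ B·AB^ B·AB^ A w m)
                  (cong₂ _+_ (leftPart-B·AB^-A B·AB^ w m) (rightPart-B·AB^-A B·AB^ w m))

T₁₁-B : ∀ w m → T₁₁ (B ∷ w) m ≡ T₀₁ w m + T₁₀ w m
T₁₁-B w m = alternatingSum-∷ B·AB^ B·AB^ B w m

T₀₀-A[] : ∀ m → T₀₀ (A ∷ []) (suc m) ≡ 0ℚ
T₀₀-A[] m = trans (T₀₀-A [] m) (cong₂ _-_ (T₁₀-[] m) (T₀₁-[] m))

T₀₀-AB : ∀ w m → T₀₀ (A ∷ B ∷ w) (suc m) ≡ 0ℚ
T₀₀-AB w m = trans (T₀₀-A (B ∷ w) m) (trans (cong₂ _-_ (T₁₀-B w m) (T₀₁-B w m)) (+-inverseʳ (T₀₀ w m)))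

T₀₀-AA : ∀ w m → T₀₀ (A ∷ A ∷ w) (suc (suc m)) ≡ - (T₁₁ w m + T₁₁ w m)
T₀₀-AA w m = trans (T₀₀-A (A ∷ w) (suc m))
  (trans (cong₂ _-_ (T₁₀-A w m) (T₀₁-A w m)) (sym (neg-distrib-+ (T₁₁ w m) (T₁₁ w m))))

T₁₁-B[] : ∀ m → T₁₁ (B ∷ []) m ≡ 0ℚ
T₁₁-B[] m = trans (T₁₁-B [] m) (cong₂ _+_ (T₀₁-[] m) (T₁₀-[] m))

T₁₁-BA : ∀ w m → T₁₁ (B ∷ A ∷ w) m ≡ 0ℚ
T₁₁-BA w zero = T₁₁-B (A ∷ w) zero
T₁₁-BA w (suc m) = trans (T₁₁-B (A ∷ w) (suc m))
  (trans (cong₂ _+_ (T₀₁-A w m) (T₁₀-A w m)) (+-inverseʳ (T₁₁ w m)))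

T₁₁-BB : ∀ w m → T₁₁ (B ∷ B ∷ w) m ≡ T₀₀ w m + T₀₀ w m
T₁₁-BB w m = trans (T₁₁-B (B ∷ w) m) (cong₂ _+_ (T₀₁-B w m) (T₁₀-B w m))

T₀₀-AABB : ∀ w m → T₀₀ (A ∷ A ∷ B ∷ B ∷ w) (suc (suc m)) ≡ - four * T₀₀ w m
T₀₀-AABB w m = begin
  T₀₀ (A ∷ A ∷ B ∷ B ∷ w) (suc (suc m))     ≡⟨ T₀₀-AA (B ∷ B ∷ w) m ⟩
  - (T₁₁ (B ∷ B ∷ w) m + T₁₁ (B ∷ B ∷ w) m) ≡⟨ cong (λ s → - (s + s)) (T₁₁-BB w m) ⟩
  - ((t + t) + (t + t))
    ≡⟨ solve 1 (λ t → :- ((t :+ t) :+ (t :+ t)) := :- con four :* t) refl t ⟩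
  - four * t                                ∎
  where
  open ≡-Reasoning
  open +-*-Solver
  t = T₀₀ w m

AABB : Word
AABB = A ∷ A ∷ B ∷ B ∷ []

T₀₀-closedForm : ∀ n w → T₀₀ w (n +ℕ n) ≡ (if (AABB ^W n) ≟W w then (- four) ^Q n else 0ℚ)
T₀₀-closedForm zero [] = refl
T₀₀-closedForm zero (x ∷ w) = refl
T₀₀-closedForm (suc n) w rewrite +-suc n n = go w
  where
  open ≡-Reasoning
  m = n +ℕ n
  vanishes-after-AA : ∀ w → T₁₁ w m ≡ 0ℚ → T₀₀ (A ∷ A ∷ w) (suc (suc m)) ≡ 0ℚ
  vanishes-after-AA w T₁₁≡0 = trans (T₀₀-AA w m) (cong (λ t → - (t + t)) T₁₁≡0)
  go : ∀ w → T₀₀ w (suc (suc m)) ≡ (if (AABB ^W suc n) ≟W w then (- four) ^Q suc n else 0ℚ)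
  go [] = T₀₀-[] (suc m)
  go (B ∷ w) = T₀₀-B w (suc (suc m))
  go (A ∷ []) = T₀₀-A[] (suc m)
  go (A ∷ B ∷ w) = T₀₀-AB w (suc m)
  go (A ∷ A ∷ []) = vanishes-after-AA [] (T₁₁-[] m)
  go (A ∷ A ∷ A ∷ w) = vanishes-after-AA (A ∷ w) (T₁₁-A w m)
  go (A ∷ A ∷ B ∷ []) = vanishes-after-AA (B ∷ []) (T₁₁-B[] m)
  go (A ∷ A ∷ B ∷ A ∷ w) = vanishes-after-AA (B ∷ A ∷ w) (T₁₁-BA w m)
  go (A ∷ A ∷ B ∷ B ∷ w) = begin
    T₀₀ (A ∷ A ∷ B ∷ B ∷ w) (suc (suc m))                     ≡⟨ T₀₀-AABB w m ⟩
    - four * T₀₀ w m                                          ≡⟨ cong (- four *_) (T₀₀-closedForm n w) ⟩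
    - four * (if (AABB ^W n) ≟W w then (- four) ^Q n else 0ℚ)
      ≡⟨ *-if-else-0ℚ (- four) ((AABB ^W n) ≟W w) ⟩
    (if (AABB ^W n) ≟W w then - four * (- four) ^Q n else 0ℚ) ∎

coeff-lhs : ∀ n w → coeff (lhs n) w ≡ sign n * T₀₀ w (n +ℕ n)
coeff-lhs n w = begin
  coeff (lhs n) w                                  ≡⟨ coeff-concatMap-applyUpTo G (λ i → i) (n +ℕ n) w ⟩
  antidiagonalSum (λ _ b → coeff (G b) w) (n +ℕ n) ≡⟨ antidiagonalSum-cong (n +ℕ n) coeff-G ⟩
  antidiagonalSum (λ a b → sign n * term a b) (n +ℕ n) ≡⟨ antidiagonalSum-* (n +ℕ n) (sign n) term ⟩
  sign n * T₀₀ w (n +ℕ n)                          ∎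
  where
  open ≡-Reasoning
  G : ℕ → Poly
  G i = scale (sign (i +ℕ n)) (AB^ ((n +ℕ n) ∸ i) ш AB^ i)
  term : ℕ → ℕ → ℚ
  term a b = sign b * shuffleCount (AB^ a) (AB^ b) w
  coeff-G : ∀ a b → a +ℕ b ≡ n +ℕ n → coeff (G b) w ≡ sign n * term a b
  coeff-G a b a+b≡n+n = begin
    coeff (G b) w
      ≡⟨ coeff-scale (sign (b +ℕ n)) (AB^ ((n +ℕ n) ∸ b) ш AB^ b) w ⟩
    sign (b +ℕ n) * coeff (AB^ ((n +ℕ n) ∸ b) ш AB^ b) w
      ≡⟨ cong (sign (b +ℕ n) *_) (coeff-ш (AB^ ((n +ℕ n) ∸ b)) (AB^ b) w) ⟩
    sign (b +ℕ n) * shuffleCount (AB^ ((n +ℕ n) ∸ b)) (AB^ b) w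
      ≡⟨ cong₂ (λ s c → s * shuffleCount (AB^ c) (AB^ b) w)
               (trans (sign-+ b n) (*-comm (sign b) (sign n)))
               (trans (cong (_∸ b) (sym a+b≡n+n)) (m+n∸n≡m a b)) ⟩
    sign n * sign b * shuffleCount (AB^ a) (AB^ b) w
      ≡⟨ *-assoc (sign n) (sign b) (shuffleCount (AB^ a) (AB^ b) w) ⟩
    sign n * term a b ∎

coeff-rhs : ∀ n w → coeff (rhs n) w ≡ (if (AABB ^W n) ≟W w then four ^Q n else 0ℚ)
coeff-rhs n w =
  trans (+-identityʳ _) (cong (λ x → if (AABB ^W n) ≟W w then x else 0ℚ) (*-identityʳ (four ^Q n)))

mainTheorem4 : ∀ (n : ℕ) → lhs n ≈P rhs n
mainTheorem4 n w = begin
  coeff (lhs n) w                                  ≡⟨ coeff-lhs n w ⟩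
  sign n * T₀₀ w (n +ℕ n)                          ≡⟨ cong (sign n *_) (T₀₀-closedForm n w) ⟩
  sign n * (if isPower then (- four) ^Q n else 0ℚ) ≡⟨ *-if-else-0ℚ (sign n) isPower ⟩
  (if isPower then sign n * (- four) ^Q n else 0ℚ)
    ≡⟨ cong (λ x → if isPower then x else 0ℚ) (sign-*-neg-^Q n four) ⟩
  (if isPower then four ^Q n else 0ℚ)              ≡⟨ coeff-rhs n w ⟨
  coeff (rhs n) w                                  ∎
  where
  open ≡-Reasoning
  isPower = (AABB ^W n) ≟W w
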